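{- Let $AP=\{p\}$. For each $n\ge1$ let $\mathcal{T}_n$ be the Kripke tree over $AP$ with an infinite path $\pi$ from the root (the main path) such that: $p$ holds at no node of $\pi$; $\pi(n+1)$ has exactly one child (namely $\pi(n+2)$); and for every $i\in\mathbb{N}\setminus\{n+1\}$, $\pi(i)$ has exactly one child $w_i$ not on $\pi$, and the subtree rooted at $w_i$ is a single infinite path whose labels form the word $\{p\}\emptyset\emptyset\emptyset\cdots$. Then for every $n\ge1$ and every CCTL$^*$ (state) formula $\varphi$ with $|\varphi|\le n$, $\mathcal{T}_n\models\varphi$ if and only if $\mathcal{T}_{n+1}\models\varphi$.
   Context: A Kripke tree over $AP$ is a non-blocking tree (nonempty prefix-closed $T\subseteq D^*$ in which every node has a child) with labelling $\mathit{Lab}:T\to2^{AP}$; an infinite path from $w$ is a sequence $\pi(0)=w$, $\pi(k+1)$ a child of $\pi(k)$. CCTL$^*$: state formulas $\varphi::=\top\mid p\mid\neg\varphi\mid\varphi\wedge\varphi\mid\mathsf{E}\psi\mid\mathsf{D}^n\varphi$ ($n\ge1$); path formulas $\psi::=\varphi\mid\neg\psi\mid\psi\wedge\psi\mid\mathsf{X}\psi\mid\psi\,\mathsf{U}\,\psi$. $(\mathcal{T},w)\models p$ iff $p\in\mathit{Lab}(w)$; $(\mathcal{T},w)\models\mathsf{E}\psi$ iff $(\mathcal{T},\pi,0)\models\psi$ for some infinite path $\pi$ from $w$; $(\mathcal{T},w)\models\mathsf{D}^n\varphi$ iff at least $n$ distinct children of $w$ satisfy $\varphi$; $(\mathcal{T},\pi,i)\models\varphi$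 iff $(\mathcal{T},\pi(i))\models\varphi$; $(\mathcal{T},\pi,i)\models\mathsf{X}\psi$ iff $(\mathcal{T},\pi,i+1)\models\psi$; $(\mathcal{T},\pi,i)\models\psi_1\mathsf{U}\psi_2$ iff for some $j\ge i$, $(\mathcal{T},\pi,j)\models\psi_2$ and $(\mathcal{T},\pi,k)\models\psi_1$ for all $i\le k<j$. $\mathcal{T}\models\varphi$ means $(\mathcal{T},\varepsilon)\models\varphi$. $|\varphi|$ denotes the length (size) of the formula $\varphi$. -}

module Defs where

open import Data.Nat using (ℕ; zero; suc; _+_; _≤_; _<_)
open import Data.List.Properties using (∷-injective; ++-assoc)
open import Data.Bool using (Bool; true; false)
open import Data.Fin using (Fin)
open import Data.List using (List; []; _∷_; _++_; [_]; replicate)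
open import Data.Product using (Σ; ∃; _×_; _,_)
open import Data.Sum using (_⊎_; inj₁; inj₂)
open import Data.Unit using (⊤; tt)
open import Data.Empty using (⊥)
open import Function.Definitions using (Injective)
open import Relation.Nullary using (¬_)
open import Relation.Binary.PropositionalEquality using (_≡_; _≢_; refl; cong; sym; trans)

-- The labelling is given as a
-- predicate Lab w a ("a ∈ Lab(w)"); only its values on nodes of T matter.

record KripkeTree (AP : Set) : Set₁ where
  field
    D           : Set
    T           : List D → Set
    root        : T []
    prefClosed  : ∀ u v → T (u ++ v) → T u
    nonBlocking : ∀ w → T w → ∃ λ d → T (w ++ [ d ])
    Lab         : List D → AP → Set

mutual
  data SF (AP : Set) : Set where
    tt'  : SF AP
    atom : AP → SF AP
    ¬ₛ   : SF AP → SF AP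
    _∧ₛ_ : SF AP → SF AP → SF AP
    E    : PF AP → SF AP
    Dᶜ   : (n : ℕ) → 1 ≤ n → SF AP → SF AP

  data PF (AP : Set) : Set where
    st   : SF AP → PF AP
    ¬ₚ   : PF AP → PF AP
    _∧ₚ_ : PF AP → PF AP → PF AP
    X    : PF AP → PF AP
    _U_  : PF AP → PF AP → PF AP

mutual
  ∣_∣ₛ : ∀ {AP} → SF AP → ℕ
  ∣ tt' ∣ₛ = 1
  ∣ atom _ ∣ₛ = 1
  ∣ ¬ₛ φ ∣ₛ = suc ∣ φ ∣ₛ
  ∣ φ ∧ₛ χ ∣ₛ = suc (∣ φ ∣ₛ + ∣ χ ∣ₛ)
  ∣ E ψ ∣ₛ = suc ∣ ψ ∣ₚ
  ∣ Dᶜ _ _ φ ∣ₛ = suc ∣ φ ∣ₛ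

  ∣_∣ₚ : ∀ {AP} → PF AP → ℕ
  ∣ st φ ∣ₚ = ∣ φ ∣ₛ
  ∣ ¬ₚ ψ ∣ₚ = suc ∣ ψ ∣ₚ
  ∣ ψ ∧ₚ χ ∣ₚ = suc (∣ ψ ∣ₚ + ∣ χ ∣ₚ)
  ∣ X ψ ∣ₚ = suc ∣ ψ ∣ₚ
  ∣ ψ U χ ∣ₚ = suc (∣ ψ ∣ₚ + ∣ χ ∣ₚ)

module Semantics {AP : Set} (𝒯 : KripkeTree AP) where
  open KripkeTree 𝒯

  record Path (w : List D) : Set where
    field
      π      : ℕ → List D
      start  : π 0 ≡ w
      inT    : ∀ k → T (π k)
      step   : ∀ k → ∃ λ d → π (suc k) ≡ π k ++ [ d ]
  open Path public

  mutual
    _⊨_ : List D → SF AP → Set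
    w ⊨ tt' = ⊤
    w ⊨ atom a = Lab w a
    w ⊨ ¬ₛ φ = ¬ (w ⊨ φ)
    w ⊨ (φ ∧ₛ χ) = (w ⊨ φ) × (w ⊨ χ)
    w ⊨ E ψ = Σ (Path w) λ ρ → ⊨ₚ (π ρ) 0 ψ
    -- at least n distinct children of w satisfy φ
    -- (children of w are the w ++ [d] ∈ T; distinct children ↔ distinct d)
    w ⊨ Dᶜ n _ φ = Σ (Fin n → D) λ f → Injective _≡_ _≡_ f ×
                   (∀ i → T (w ++ [ f i ]) × ((w ++ [ f i ]) ⊨ φ))

    ⊨ₚ : (ℕ → List D) → ℕ → PF AP → Set
    ⊨ₚ ρ i (st φ) = ρ i ⊨ φ
    ⊨ₚ ρ i (¬ₚ ψ) = ¬ ⊨ₚ ρ i ψ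
    ⊨ₚ ρ i (ψ ∧ₚ χ) = ⊨ₚ ρ i ψ × ⊨ₚ ρ i χ
    ⊨ₚ ρ i (X ψ) = ⊨ₚ ρ (suc i) ψ
    ⊨ₚ ρ i (ψ U χ) = ∃ λ j → (i ≤ j) × ⊨ₚ ρ j χ × (∀ k → i ≤ k → k < j → ⊨ₚ ρ k ψ)

_⊨_ : ∀ {AP} (𝒯 : KripkeTree AP) → SF AP → Set
𝒯 ⊨ φ = Semantics._⊨_ 𝒯 [] φ

-- The trees 𝒯ₙ over AP = {p} (AP represented by ⊤, p = tt).
-- Directions D = Bool; main path π(i) = falseⁱ; the side child of π(i)
-- is w_i = falseⁱ ++ [true], whose subtree is the single path
-- falseⁱ ++ true ∷ falseʲ (j ≥ 0).

data Tn (n : ℕ) : List Bool → Set where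
  main : ∀ i → Tn n (replicate i false)
  side : ∀ i j → i ≢ suc n → Tn n (replicate i false ++ true ∷ replicate j false)

Labn : List Bool → ⊤ → Set
Labn w _ = ∃ λ i → w ≡ replicate i false ++ [ true ]

private
  rep-snoc : ∀ i → replicate i false ++ [ false ] ≡ replicate (suc i) false
  rep-snoc zero = refl
  rep-snoc (suc i) = cong (false ∷_) (rep-snoc i)

  subst' : ∀ {n} {a b : List Bool} → a ≡ b → Tn n a → Tn n b
  subst' refl t = t

  prefA : ∀ (u v : List Bool) i → u ++ v ≡ replicate i false → ∃ λ k → u ≡ replicate k false
  prefA [] v i eq = 0 , refl
  prefA (x ∷ u) v zero ()
  prefA (x ∷ u) v (suc i) eq with ∷-injective eq
  ... | refl , eq' with prefA u v i eq'
  ... | k , e = suc k , cong (false ∷_) e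

  prefB : ∀ (u v : List Bool) i j → u ++ v ≡ replicate i false ++ true ∷ replicate j false →
          (∃ λ k → u ≡ replicate k false) ⊎ (∃ λ k → u ≡ replicate i false ++ true ∷ replicate k false)
  prefB [] v i j eq = inj₁ (0 , refl)
  prefB (x ∷ u) v zero j eq with ∷-injective eq
  ... | refl , eq' with prefA u v j eq'
  ... | k , e = inj₂ (k , cong (true ∷_) e)
  prefB (x ∷ u) v (suc i) j eq with ∷-injective eq
  ... | refl , eq' with prefB u v i j eq'
  ... | inj₁ (k , e) = inj₁ (suc k , cong (false ∷_) e)
  ... | inj₂ (k , e) = inj₂ (k , cong (false ∷_) e)

  pc : ∀ n u v w → u ++ v ≡ w → Tn n w → Tn n u
  pc n u v _ eq (main i) with prefA u v i eq
  ... | k , e = subst' (sym e) (main k)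
  pc n u v _ eq (side i j ne) with prefB u v i j eq
  ... | inj₁ (k , e) = subst' (sym e) (main k)
  ... | inj₂ (k , e) = subst' (sym e) (side i k ne)

  nb : ∀ n w → Tn n w → ∃ λ d → Tn n (w ++ [ d ])
  nb n _ (main i) = false , subst' (sym (rep-snoc i)) (main (suc i))
  nb n _ (side i j ne) = false , subst' eq (side i (suc j) ne)
    where
      eq : replicate i false ++ true ∷ replicate (suc j) false
         ≡ (replicate i false ++ true ∷ replicate j false) ++ [ false ]
      eq = trans (cong (λ r → replicate i false ++ true ∷ r) (sym (rep-snoc j)))
                 (sym (++-assoc (replicate i false) (true ∷ replicate j false) [ false ]))

𝒯 : ℕ → KripkeTree ⊤
𝒯 n = record
  { D = Bool
  ; T = Tn n
  ; root = main 0
  ; prefClosed = λ u v t → pc n u v (u ++ v) refl t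
  ; nonBlocking = nb n
  ; Lab = Labn
  }

{-# OPTIONS --safe #-}
module Submission where

-- Prepending a step along the main path embeds 𝒯ₙ into 𝒯ₙ₊₁, mapping π(i) to π(i+1), and the
-- side branches at w_i with i ≤ n are the same in both trees. By induction on |φ|, π(i)
-- satisfies φ in 𝒯ₙ iff it does in 𝒯ₙ₊₁ whenever i + |φ| ≤ n. For E ψ let d be the number of
-- X's in ψ. A path from π(i) that turns into a side branch within d steps is a path of both
-- trees, and its nodes agree either by induction or because they lie in a shared side branch.
-- A path that stays on the main path for d steps is matched with a path of the other tree that
-- lingers one step more (or less) on the main path: the two coincide for d steps and are
-- afterwards one position apart, which ψ cannot detect, since X looks at most d steps ahead
-- and U is insensitive to repeating a position.

open import Defs
open import Algebra.Properties.CommutativeSemigroup using (interchange)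
open import Data.Bool using (Bool; true; false)
open import Data.Empty using (⊥-elim)
open import Data.List using (List; []; _∷_; _++_; [_]; _∷ʳ_; replicate)
open import Data.List.Properties using (∷-injectiveʳ; ∷ʳ-injectiveˡ; ++-assoc; ++-identityʳ)
open import Data.Nat using (ℕ; zero; suc; _+_; _≤_; _<_; _≤′_; ≤′-refl; ≤′-step; z≤n; s≤s)
open import Data.Nat.Induction using (<-wellFounded)
open import Data.Nat.Properties
  using (≤-refl; ≤-trans; ≤-reflexive; <⇒≤; <⇒≢; <⇒≱; ≰⇒>; _≤?_; ≤⇒≤′; n≤1+n; m≤n⇒m≤1+n; m<n⇒m<1+n;
         m≤n⇒m<n∨m≡n; m≤m+n; m≤n+m; m+n≤o⇒m≤o; m+n≤o⇒n≤o; +-mono-≤; +-monoˡ-≤; +-monoʳ-≤;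
         +-suc; +-comm; +-assoc; suc-injective; +-commutativeSemigroup; module ≤-Reasoning)
open import Data.Product using (∃; _×_; _,_; proj₁; proj₂)
open import Data.Product.Function.NonDependent.Propositional using (_×-⇔_)
open import Data.Sum using (_⊎_; inj₁; inj₂)
open import Data.Sum.Function.Propositional using (_⊎-⇔_)
open import Data.Unit using (⊤; tt)
open import Function.Base using (_∘_)
open import Function.Bundles using (_⇔_; mk⇔; Equivalence)
import Function.Properties.Equivalence as ⇔
open import Function.Related.Propositional using (module EquationalReasoning)
open import Function.Related.TypeIsomorphisms using (¬-cong-⇔)
open import Induction.WellFounded using (module All)
open import Level using (0ℓ)
import Relation.Binary.Construct.On as On
open import Relation.Binary.PropositionalEquality as ≡ using (_≡_; _≢_; refl; cong; subst; subst₂)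
open import Relation.Nullary using (yes; no)

open Equivalence using (to; from)
open Semantics using (Path; π; start; inT; step)

size-induction : ∀ {AP} (P : SF AP → Set) →
                 (∀ φ → (∀ {χ} → ∣ χ ∣ₛ < ∣ φ ∣ₛ → P χ) → P φ) → ∀ φ → P φ
size-induction P = All.wfRec (On.wellFounded ∣_∣ₛ <-wellFounded) 0ℓ P

nextCount : ∀ {AP} → PF AP → ℕ
nextCount (st _)   = 0
nextCount (¬ₚ ψ)   = nextCount ψ
nextCount (ψ ∧ₚ χ) = nextCount ψ + nextCount χ
nextCount (X ψ)    = suc (nextCount ψ)
nextCount (ψ U χ)  = nextCount ψ + nextCount χ

leafSize : ∀ {AP} → PF AP → ℕ
leafSize (st φ)   = ∣ φ ∣ₛ
leafSize (¬ₚ ψ)   = leafSize ψ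
leafSize (ψ ∧ₚ χ) = leafSize ψ + leafSize χ
leafSize (X ψ)    = leafSize ψ
leafSize (ψ U χ)  = leafSize ψ + leafSize χ

mutual
  nextCount+leafSize≤∣∣ₚ : ∀ {AP} (ψ : PF AP) → nextCount ψ + leafSize ψ ≤ ∣ ψ ∣ₚ
  nextCount+leafSize≤∣∣ₚ (st φ)   = ≤-refl
  nextCount+leafSize≤∣∣ₚ (¬ₚ ψ)   = m≤n⇒m≤1+n (nextCount+leafSize≤∣∣ₚ ψ)
  nextCount+leafSize≤∣∣ₚ (ψ ∧ₚ χ) = m≤n⇒m≤1+n (nextCount+leafSize≤∣∣ₚ-binary ψ χ)
  nextCount+leafSize≤∣∣ₚ (X ψ)    = s≤s (nextCount+leafSize≤∣∣ₚ ψ)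
  nextCount+leafSize≤∣∣ₚ (ψ U χ)  = m≤n⇒m≤1+n (nextCount+leafSize≤∣∣ₚ-binary ψ χ)

  nextCount+leafSize≤∣∣ₚ-binary : ∀ {AP} (ψ χ : PF AP) →
    (nextCount ψ + nextCount χ) + (leafSize ψ + leafSize χ) ≤ ∣ ψ ∣ₚ + ∣ χ ∣ₚ
  nextCount+leafSize≤∣∣ₚ-binary ψ χ =
    ≤-trans (≤-reflexive (interchange +-commutativeSemigroup
                            (nextCount ψ) (nextCount χ) (leafSize ψ) (leafSize χ)))
            (+-mono-≤ (nextCount+leafSize≤∣∣ₚ ψ) (nextCount+leafSize≤∣∣ₚ χ))

leafSize≤∣∣ₚ : ∀ {AP} (ψ : PF AP) → leafSize ψ ≤ ∣ ψ ∣ₚ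
leafSize≤∣∣ₚ ψ = m+n≤o⇒n≤o (nextCount ψ) (nextCount+leafSize≤∣∣ₚ ψ)

module _ {AP : Set} {𝒜 : KripkeTree AP} where
  open KripkeTree 𝒜 using (D; T)
  open Semantics 𝒜 using (⊨ₚ)

  direction : ∀ {w} → Path 𝒜 w → ℕ → D
  direction ρ k = proj₁ (step ρ k)

  π-suc : ∀ {w} (ρ : Path 𝒜 w) k → π ρ (suc k) ≡ π ρ k ∷ʳ direction ρ k
  π-suc ρ k = proj₂ (step ρ k)

  suffix : ∀ {w} → Path 𝒜 w → ℕ → List D
  suffix ρ zero    = []
  suffix ρ (suc k) = suffix ρ k ∷ʳ direction ρ k

  π≡++suffix : ∀ {w} (ρ : Path 𝒜 w) k → π ρ k ≡ w ++ suffix ρ k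
  π≡++suffix {w} ρ zero    = ≡.trans (start ρ) (≡.sym (++-identityʳ w))
  π≡++suffix {w} ρ (suc k) = begin
    π ρ (suc k)                        ≡⟨ π-suc ρ k ⟩
    π ρ k ∷ʳ direction ρ k             ≡⟨ cong (_∷ʳ direction ρ k) (π≡++suffix ρ k) ⟩
    (w ++ suffix ρ k) ∷ʳ direction ρ k ≡⟨ ++-assoc w (suffix ρ k) _ ⟩
    w ++ suffix ρ (suc k)              ∎
    where open ≡.≡-Reasoning

  π-prefix : ∀ {w} (ρ : Path 𝒜 w) {m k} → m ≤ k → ∃ λ x → π ρ k ≡ π ρ m ++ x
  π-prefix ρ {m} m≤k = go (≤⇒≤′ m≤k)
    where
    open ≡.≡-Reasoning
    go : ∀ {k} → m ≤′ k → ∃ λ x → π ρ k ≡ π ρ m ++ x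
    go ≤′-refl = [] , ≡.sym (++-identityʳ _)
    go (≤′-step {k} m≤′k) with x , e ← go m≤′k = x ∷ʳ direction ρ k , (begin
      π ρ (suc k)                ≡⟨ π-suc ρ k ⟩
      π ρ k ∷ʳ direction ρ k     ≡⟨ cong (_∷ʳ direction ρ k) e ⟩
      (π ρ m ++ x) ∷ʳ direction ρ k ≡⟨ ++-assoc (π ρ m) x _ ⟩
      π ρ m ++ (x ∷ʳ direction ρ k) ∎)

  tail : ∀ {w v} (ρ : Path 𝒜 w) → π ρ 1 ≡ v → Path 𝒜 v
  tail ρ e = record { π = π ρ ∘ suc ; start = e ; inT = inT ρ ∘ suc ; step = step ρ ∘ suc }

  cons : ∀ {w v d} → T w → Path 𝒜 v → v ≡ w ∷ʳ d → Path 𝒜 w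
  cons {w} {d = d} w∈T ρ e = record
    { π     = λ { zero → w ; (suc k) → π ρ k }
    ; start = refl
    ; inT   = λ { zero → w∈T ; (suc k) → inT ρ k }
    ; step  = λ { zero → d , ≡.trans (start ρ) e ; (suc k) → step ρ k }
    }

  ⊨ₚ-suc : ∀ {ρ : ℕ → List D} ψ k → ⊨ₚ ρ (suc k) ψ ⇔ ⊨ₚ (ρ ∘ suc) k ψ
  ⊨ₚ-suc (st φ)   k = ⇔.refl
  ⊨ₚ-suc (¬ₚ ψ)   k = ¬-cong-⇔ (⊨ₚ-suc ψ k)
  ⊨ₚ-suc (ψ ∧ₚ χ) k = ⊨ₚ-suc ψ k ×-⇔ ⊨ₚ-suc χ k
  ⊨ₚ-suc (X ψ)    k = ⊨ₚ-suc ψ (suc k)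
  ⊨ₚ-suc {ρ} (ψ U χ) k = mk⇔ shift unshift
    where
    shift : ⊨ₚ ρ (suc k) (ψ U χ) → ⊨ₚ (ρ ∘ suc) k (ψ U χ)
    shift (zero , () , _)
    shift (suc j , s≤s k≤j , χj , ψ<j) = j , k≤j , to (⊨ₚ-suc χ j) χj ,
      λ m k≤m m<j → to (⊨ₚ-suc ψ m) (ψ<j (suc m) (s≤s k≤m) (s≤s m<j))
    unshift : ⊨ₚ (ρ ∘ suc) k (ψ U χ) → ⊨ₚ ρ (suc k) (ψ U χ)
    unshift (j , k≤j , χj , ψ<j) = suc j , s≤s k≤j , from (⊨ₚ-suc χ j) χj ,
      λ { zero () _ ; (suc m) (s≤s k≤m) (s≤s m<j) → from (⊨ₚ-suc ψ m) (ψ<j m k≤m m<j) }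

  U-unfold : ∀ {ρ : ℕ → List D} ψ χ k →
             ⊨ₚ ρ k (ψ U χ) ⇔ (⊨ₚ ρ k χ ⊎ (⊨ₚ ρ k ψ × ⊨ₚ ρ (suc k) (ψ U χ)))
  U-unfold {ρ} ψ χ k = mk⇔ unfold fold
    where
    unfold : ⊨ₚ ρ k (ψ U χ) → ⊨ₚ ρ k χ ⊎ (⊨ₚ ρ k ψ × ⊨ₚ ρ (suc k) (ψ U χ))
    unfold (j , k≤j , χj , ψ<j) with m≤n⇒m<n∨m≡n k≤j
    ... | inj₂ refl = inj₁ χj
    ... | inj₁ k<j  = inj₂ (ψ<j k ≤-refl k<j , j , k<j , χj , λ m k<m → ψ<j m (<⇒≤ k<m))
    fold : ⊨ₚ ρ k χ ⊎ (⊨ₚ ρ k ψ × ⊨ₚ ρ (suc k) (ψ U χ)) → ⊨ₚ ρ k (ψ U χ)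
    fold (inj₁ χk) = k , ≤-refl , χk , λ m k≤m m<k → ⊥-elim (<⇒≱ m<k k≤m)
    fold (inj₂ (ψk , j , k<j , χj , ψ<j)) = j , <⇒≤ k<j , χj , before
      where
      before : ∀ m → k ≤ m → m < j → ⊨ₚ ρ m ψ
      before m k≤m m<j with m≤n⇒m<n∨m≡n k≤m
      ... | inj₂ refl = ψk
      ... | inj₁ k<m  = ψ<j m k<m m<j

  U-absorb : ∀ {ρ : ℕ → List D} ψ χ k →
             ⊨ₚ ρ k (ψ U χ) ⇔ (⊨ₚ ρ k χ ⊎ (⊨ₚ ρ k ψ × ⊨ₚ ρ k (ψ U χ)))
  U-absorb {ρ} ψ χ k = mk⇔ unfold fold
    where
    unfold : ⊨ₚ ρ k (ψ U χ) → ⊨ₚ ρ k χ ⊎ (⊨ₚ ρ k ψ × ⊨ₚ ρ k (ψ U χ))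
    unfold sat@(j , k≤j , χj , ψ<j) with m≤n⇒m<n∨m≡n k≤j
    ... | inj₂ refl = inj₁ χj
    ... | inj₁ k<j  = inj₂ (ψ<j k ≤-refl k<j , sat)
    fold : ⊨ₚ ρ k χ ⊎ (⊨ₚ ρ k ψ × ⊨ₚ ρ k (ψ U χ)) → ⊨ₚ ρ k (ψ U χ)
    fold (inj₁ χk)      = from (U-unfold ψ χ k) (inj₁ χk)
    fold (inj₂ (_ , sat)) = sat

module _ {AP : Set} {𝒜 ℬ : KripkeTree AP} where
  private
    module A = Semantics 𝒜
    module B = Semantics ℬ
    Dᴬ Dᴮ : Set
    Dᴬ = KripkeTree.D 𝒜
    Dᴮ = KripkeTree.D ℬ

  U-cong : ∀ {ρ : ℕ → List Dᴬ} {ρ′ : ℕ → List Dᴮ} ψ χ →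
           (∀ k → A.⊨ₚ ρ k ψ ⇔ B.⊨ₚ ρ′ k ψ) → (∀ k → A.⊨ₚ ρ k χ ⇔ B.⊨ₚ ρ′ k χ) →
           ∀ k → A.⊨ₚ ρ k (ψ U χ) ⇔ B.⊨ₚ ρ′ k (ψ U χ)
  U-cong _ _ ψ⇔ χ⇔ k = mk⇔
    (λ (j , k≤j , χj , ψ<j) → j , k≤j , to (χ⇔ j) χj , λ m k≤m m<j → to (ψ⇔ m) (ψ<j m k≤m m<j))
    (λ (j , k≤j , χj , ψ<j) → j , k≤j , from (χ⇔ j) χj , λ m k≤m m<j → from (ψ⇔ m) (ψ<j m k≤m m<j))

  ⊨ₚ-cong : ∀ {ρ : ℕ → List Dᴬ} {ρ′ : ℕ → List Dᴮ} {c} →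
            (∀ k φ → ∣ φ ∣ₛ ≤ c → ρ k A.⊨ φ ⇔ ρ′ k B.⊨ φ) →
            ∀ ψ → leafSize ψ ≤ c → ∀ k → A.⊨ₚ ρ k ψ ⇔ B.⊨ₚ ρ′ k ψ
  ⊨ₚ-cong agree (st φ)   φ≤c k = agree k φ φ≤c
  ⊨ₚ-cong agree (¬ₚ ψ)   ψ≤c k = ¬-cong-⇔ (⊨ₚ-cong agree ψ ψ≤c k)
  ⊨ₚ-cong agree (ψ ∧ₚ χ) ≤c  k =
    ⊨ₚ-cong agree ψ (m+n≤o⇒m≤o _ ≤c) k ×-⇔ ⊨ₚ-cong agree χ (m+n≤o⇒n≤o _ ≤c) k
  ⊨ₚ-cong agree (X ψ)    ψ≤c k = ⊨ₚ-cong agree ψ ψ≤c (suc k)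
  ⊨ₚ-cong agree (ψ U χ)  ≤c  k =
    U-cong ψ χ (⊨ₚ-cong agree ψ (m+n≤o⇒m≤o _ ≤c)) (⊨ₚ-cong agree χ (m+n≤o⇒n≤o _ ≤c)) k

  module _ {ρ : ℕ → List Dᴬ} {ρ′ : ℕ → List Dᴮ} {d c : ℕ}
    (early   : ∀ k φ → k ≤ d → ∣ φ ∣ₛ ≤ c → ρ k A.⊨ φ ⇔ ρ′ k B.⊨ φ)
    (delayed : ∀ k φ → ∣ φ ∣ₛ ≤ c → ρ k A.⊨ φ ⇔ ρ′ (suc k) B.⊨ φ) where

    ⊨ₚ-delayed : ∀ ψ → leafSize ψ ≤ c → ∀ k → A.⊨ₚ ρ k ψ ⇔ B.⊨ₚ ρ′ (suc k) ψ
    ⊨ₚ-delayed ψ ψ≤c k =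
      ⇔.trans (⊨ₚ-cong {ρ′ = ρ′ ∘ suc} delayed ψ ψ≤c k) (⇔.sym (⊨ₚ-suc {𝒜 = ℬ} ψ k))

    ⊨ₚ-stutter : ∀ ψ k → k + nextCount ψ ≤ d → leafSize ψ ≤ c → A.⊨ₚ ρ k ψ ⇔ B.⊨ₚ ρ′ k ψ
    ⊨ₚ-stutter (st φ)   k k≤d φ≤c = early k φ (m+n≤o⇒m≤o k k≤d) φ≤c
    ⊨ₚ-stutter (¬ₚ ψ)   k k≤d ψ≤c = ¬-cong-⇔ (⊨ₚ-stutter ψ k k≤d ψ≤c)
    ⊨ₚ-stutter (ψ ∧ₚ χ) k k≤d ≤c  =
      ⊨ₚ-stutter ψ k (≤-trans (+-monoʳ-≤ k (m≤m+n _ _)) k≤d) (m+n≤o⇒m≤o _ ≤c) ×-⇔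
      ⊨ₚ-stutter χ k (≤-trans (+-monoʳ-≤ k (m≤n+m _ _)) k≤d) (m+n≤o⇒n≤o _ ≤c)
    ⊨ₚ-stutter (X ψ)    k k≤d ψ≤c =
      ⊨ₚ-stutter ψ (suc k) (≤-trans (≤-reflexive (≡.sym (+-suc k _))) k≤d) ψ≤c
    -- After one unfolding on the ρ′ side, the remaining ψ U χ sits at k + 1 in ρ′ and at k in ρ.
    ⊨ₚ-stutter (ψ U χ)  k k≤d ≤c  = begin
      A.⊨ₚ ρ k (ψ U χ)
        ∼⟨ U-absorb ψ χ k ⟩
      (A.⊨ₚ ρ k χ ⊎ (A.⊨ₚ ρ k ψ × A.⊨ₚ ρ k (ψ U χ)))
        ∼⟨ now-χ ⊎-⇔ (now-ψ ×-⇔ ⊨ₚ-delayed (ψ U χ) ≤c k) ⟩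
      (B.⊨ₚ ρ′ k χ ⊎ (B.⊨ₚ ρ′ k ψ × B.⊨ₚ ρ′ (suc k) (ψ U χ)))
        ∼⟨ ⇔.sym (U-unfold ψ χ k) ⟩
      B.⊨ₚ ρ′ k (ψ U χ)
        ∎
      where
      open EquationalReasoning
      now-ψ : A.⊨ₚ ρ k ψ ⇔ B.⊨ₚ ρ′ k ψ
      now-ψ = ⊨ₚ-stutter ψ k (≤-trans (+-monoʳ-≤ k (m≤m+n _ _)) k≤d) (m+n≤o⇒m≤o _ ≤c)
      now-χ : A.⊨ₚ ρ k χ ⇔ B.⊨ₚ ρ′ k χ
      now-χ = ⊨ₚ-stutter χ k (≤-trans (+-monoʳ-≤ k (m≤n+m _ _)) k≤d) (m+n≤o⇒n≤o _ ≤c)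

spine : ℕ → List Bool
spine i = replicate i false

sideRoot : ℕ → List Bool
sideRoot i = spine i ∷ʳ true

spine-∷ʳ : ∀ i → spine i ∷ʳ false ≡ spine (suc i)
spine-∷ʳ zero    = refl
spine-∷ʳ (suc i) = cong (false ∷_) (spine-∷ʳ i)

spine≢spine++true∷ : ∀ i m {x} → spine i ≢ spine m ++ true ∷ x
spine≢spine++true∷ (suc i) (suc m) e = spine≢spine++true∷ i m (∷-injectiveʳ e)
spine≢spine++true∷ zero    zero    ()
spine≢spine++true∷ zero    (suc m) ()
spine≢spine++true∷ (suc i) zero    ()

spine++true∷-injectiveʳ : ∀ i m {x y} → spine i ++ true ∷ x ≡ spine m ++ true ∷ y → x ≡ y
spine++true∷-injectiveʳ zero    zero    refl = refl
spine++true∷-injectiveʳ (suc i) (suc m) e    = spine++true∷-injectiveʳ i m (∷-injectiveʳ e)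
spine++true∷-injectiveʳ zero    (suc m) ()
spine++true∷-injectiveʳ (suc i) zero    ()

Sat : ℕ → List Bool → SF ⊤ → Set
Sat a = Semantics._⊨_ (𝒯 a)

Tn-false∷ : ∀ {a w} → Tn a w ⇔ Tn (suc a) (false ∷ w)
Tn-false∷ = mk⇔ push (λ t → pop t refl)
  where
  push : ∀ {a w} → Tn a w → Tn (suc a) (false ∷ w)
  push (main i)       = main (suc i)
  push (side i j i≢a) = side (suc i) j (i≢a ∘ suc-injective)
  pop : ∀ {a v w} → Tn (suc a) v → v ≡ false ∷ w → Tn a w
  pop (main zero)          ()
  pop (main (suc i))       refl = main i
  pop (side zero j _)      ()
  pop (side (suc i) j i≢a) refl = side i j (i≢a ∘ cong suc)

Labn-false∷ : ∀ {w} → Labn w tt ⇔ Labn (false ∷ w) tt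
Labn-false∷ = mk⇔ (λ (i , e) → suc i , cong (false ∷_) e)
                  (λ { (zero , ()) ; (suc i , e) → i , ∷-injectiveʳ e })

below-sideRoot : ∀ {a v m x} → Tn a v → v ≡ spine m ++ true ∷ x → ∃ λ j → x ≡ spine j
below-sideRoot (main i)     e = ⊥-elim (spine≢spine++true∷ i _ e)
below-sideRoot (side i j _) e = j , ≡.sym (spine++true∷-injectiveʳ i _ e)

SameSubtree : ℕ → ℕ → List Bool → List Bool → Set
SameSubtree a b u v = ∀ x → (Tn a (u ++ x) ⇔ Tn b (v ++ x)) × (Labn (u ++ x) tt ⇔ Labn (v ++ x) tt)

SameSubtree-sym : ∀ {a b u v} → SameSubtree a b u v → SameSubtree b a v u
SameSubtree-sym s x = ⇔.sym (proj₁ (s x)) , ⇔.sym (proj₂ (s x))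

SameSubtree-++ : ∀ {a b u v} → SameSubtree a b u v → ∀ y → SameSubtree a b (u ++ y) (v ++ y)
SameSubtree-++ {a} {b} {u} {v} s y x =
  subst₂ (λ u′ v′ → (Tn a u′ ⇔ Tn b v′) × (Labn u′ tt ⇔ Labn v′ tt))
         (≡.sym (++-assoc u y x)) (≡.sym (++-assoc v y x)) (s (y ++ x))

SameSubtree-root : ∀ {a b u v} → SameSubtree a b u v → (Tn a u ⇔ Tn b v) × (Labn u tt ⇔ Labn v tt)
SameSubtree-root {a} {b} {u} {v} s =
  subst₂ (λ u′ v′ → (Tn a u′ ⇔ Tn b v′) × (Labn u′ tt ⇔ Labn v′ tt))
         (++-identityʳ u) (++-identityʳ v) (s [])

false∷-SameSubtree : ∀ {a} u → SameSubtree a (suc a) u (false ∷ u)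
false∷-SameSubtree u x = Tn-false∷ , Labn-false∷

sideRoot-SameSubtree : ∀ {a b m} → m ≢ suc a → m ≢ suc b → SameSubtree a b (sideRoot m) (sideRoot m)
sideRoot-SameSubtree {a} {b} {m} m≢a m≢b x =
  subst (λ w → Tn a w ⇔ Tn b w) (≡.sym (++-assoc (spine m) [ true ] x))
        (mk⇔ (move m≢b) (move m≢a)) ,
  ⇔.refl
  where
  move : ∀ {a b} → m ≢ suc b → Tn a (spine m ++ true ∷ x) → Tn b (spine m ++ true ∷ x)
  move m≢ t with j , refl ← below-sideRoot t refl = side m j m≢

Dᶜ-cong : ∀ {a b u v m} {1≤m : 1 ≤ m} {φ} →
          (∀ d → (Tn a (u ∷ʳ d) × Sat a (u ∷ʳ d) φ) ⇔ (Tn b (v ∷ʳ d) × Sat b (v ∷ʳ d) φ)) →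
          Sat a u (Dᶜ m 1≤m φ) ⇔ Sat b v (Dᶜ m 1≤m φ)
Dᶜ-cong children = mk⇔
  (λ (f , f-inj , sat) → f , f-inj , λ i → to (children (f i)) (sat i))
  (λ (f , f-inj , sat) → f , f-inj , λ i → from (children (f i)) (sat i))

relocate : ∀ {a b u v} → SameSubtree a b u v → Path (𝒯 a) u → Path (𝒯 b) v
relocate {a} {v = v} s ρ = record
  { π     = λ k → v ++ suffix ρ k
  ; start = ++-identityʳ v
  ; inT   = λ k → to (proj₁ (s (suffix ρ k))) (subst (Tn a) (π≡++suffix ρ k) (inT ρ k))
  ; step  = λ k → direction ρ k , ≡.sym (++-assoc v (suffix ρ k) _)
  }

relocate-SameSubtree : ∀ {a b u v} (s : SameSubtree a b u v) (ρ : Path (𝒯 a) u) k →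
                       SameSubtree a b (π ρ k) (π (relocate s ρ) k)
relocate-SameSubtree {a} {b} {v = v} s ρ k =
  subst (λ w → SameSubtree a b w (v ++ suffix ρ k)) (≡.sym (π≡++suffix ρ k))
        (SameSubtree-++ s (suffix ρ k))

SameSubtree-Sat : ∀ φ {a b u v} → SameSubtree a b u v → Sat a u φ ⇔ Sat b v φ
SameSubtree-Sat = size-induction Preserved preserved
  where
  Preserved : SF ⊤ → Set
  Preserved φ = ∀ {a b u v} → SameSubtree a b u v → Sat a u φ ⇔ Sat b v φ
  preserved : ∀ φ → (∀ {χ} → ∣ χ ∣ₛ < ∣ φ ∣ₛ → Preserved χ) → Preserved φ
  preserved tt'          _  _ = ⇔.refl
  preserved (atom _)     _  s = proj₂ (SameSubtree-root s)
  preserved (¬ₛ φ)       ih s = ¬-cong-⇔ (ih {φ} ≤-refl s)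
  preserved (φ ∧ₛ χ)     ih s = ih {φ} (s≤s (m≤m+n _ _)) s ×-⇔ ih {χ} (s≤s (m≤n+m _ _)) s
  preserved (Dᶜ m 1≤m φ) ih s = Dᶜ-cong {1≤m = 1≤m} {φ} λ d →
    proj₁ (SameSubtree-root (SameSubtree-++ s [ d ])) ×-⇔ ih {φ} ≤-refl (SameSubtree-++ s [ d ])
  preserved (E ψ)        ih s = mk⇔ (along s) (along (SameSubtree-sym s))
    where
    along : ∀ {a b u v} → SameSubtree a b u v → Sat a u (E ψ) → Sat b v (E ψ)
    along s (ρ , sat) = relocate s ρ , to (⊨ₚ-cong agree ψ ≤-refl 0) sat
      where
      agree : ∀ k φ → ∣ φ ∣ₛ ≤ leafSize ψ → Sat _ (π ρ k) φ ⇔ Sat _ (π (relocate s ρ) k) φ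
      agree k φ φ≤ψ = ih {φ} (s≤s (≤-trans φ≤ψ (leafSize≤∣∣ₚ ψ))) (relocate-SameSubtree s ρ k)

module _ {a : ℕ} where

  spine-pred : ∀ {w k j} (ρ : Path (𝒯 a) w) → π ρ (suc k) ≡ spine (suc j) → π ρ k ≡ spine j
  spine-pred {k = k} {j} ρ on =
    ∷ʳ-injectiveˡ _ _ (≡.trans (≡.sym (π-suc ρ k)) (≡.trans on (≡.sym (spine-∷ʳ j))))

  on-spine-before : ∀ {i k j} (ρ : Path (𝒯 a) (spine i)) →
                    π ρ k ≡ spine (k + i) → j ≤ k → π ρ j ≡ spine (j + i)
  on-spine-before {i} {j = j} ρ on j≤k = go (≤⇒≤′ j≤k) on
    where
    go : ∀ {k} → j ≤′ k → π ρ k ≡ spine (k + i) → π ρ j ≡ spine (j + i)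
    go ≤′-refl        on = on
    go (≤′-step j≤′k) on = go j≤′k (spine-pred ρ on)

  spine-step : ∀ {w k j} (ρ : Path (𝒯 a) w) → π ρ k ≡ spine j →
               π ρ (suc k) ≡ spine (suc j) ⊎ π ρ (suc k) ≡ sideRoot j
  spine-step {k = k} {j} ρ on with direction ρ k | π-suc ρ k
  ... | false | e = inj₁ (≡.trans e (≡.trans (cong (_∷ʳ false) on) (spine-∷ʳ j)))
  ... | true  | e = inj₂ (≡.trans e (cong (_∷ʳ true) on))

  spine-or-turn : ∀ {i} (ρ : Path (𝒯 a) (spine i)) d →
                  π ρ d ≡ spine (d + i) ⊎
                  ∃ λ t → t < d × π ρ t ≡ spine (t + i) × π ρ (suc t) ≡ sideRoot (t + i)
  spine-or-turn ρ zero = inj₁ (start ρ)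
  spine-or-turn ρ (suc d) with spine-or-turn ρ d
  ... | inj₂ (t , t<d , turn) = inj₂ (t , m<n⇒m<1+n t<d , turn)
  ... | inj₁ on with spine-step ρ on
  ...   | inj₁ on′ = inj₁ on′
  ...   | inj₂ off = inj₂ (d , ≤-refl , on , off)

  stretch : ∀ {i} → Path (𝒯 a) (spine i) → Path (𝒯 (suc a)) (spine i)
  stretch {i} ρ = cons (main i) (relocate (false∷-SameSubtree (spine i)) ρ) (≡.sym (spine-∷ʳ i))

  stretch-suc : ∀ {i} (ρ : Path (𝒯 a) (spine i)) k → false ∷ π ρ k ≡ π (stretch ρ) (suc k)
  stretch-suc ρ k = cong (false ∷_) (π≡++suffix ρ k)

  unstretch : ∀ {i} (ρ : Path (𝒯 (suc a)) (spine i)) → π ρ 1 ≡ spine (suc i) → Path (𝒯 a) (spine i)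
  unstretch ρ e = relocate (SameSubtree-sym (false∷-SameSubtree _)) (tail ρ e)

  unstretch-suc : ∀ {i} (ρ : Path (𝒯 (suc a)) (spine i)) (e : π ρ 1 ≡ spine (suc i)) k →
                  false ∷ π (unstretch ρ e) k ≡ π ρ (suc k)
  unstretch-suc ρ e k = ≡.sym (π≡++suffix (tail ρ e) k)

module TurningPaths {a b m c : ℕ}
  (spine-agree   : ∀ j φ → j ≤ m → ∣ φ ∣ₛ ≤ c → Sat a (spine j) φ ⇔ Sat b (spine j) φ)
  (sideRoot-same : ∀ j → j ≤ m → SameSubtree a b (sideRoot j) (sideRoot j)) where

  NodeAgree : List Bool → Set
  NodeAgree w = (Tn a w ⇔ Tn b w) × (∀ φ → ∣ φ ∣ₛ ≤ c → Sat a w φ ⇔ Sat b w φ)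

  E-along : ∀ {w} ψ (ρ : Path (𝒯 a) w) → (∀ k → NodeAgree (π ρ k)) → leafSize ψ ≤ c →
            Semantics.⊨ₚ (𝒯 a) (π ρ) 0 ψ → Sat b w (E ψ)
  E-along {w} ψ ρ agree ψ≤c sat = ρ′ , to (⊨ₚ-cong (λ k → proj₂ (agree k)) ψ ψ≤c 0) sat
    where
    ρ′ : Path (𝒯 b) w
    ρ′ = record { π = π ρ ; start = start ρ ; step = step ρ
                ; inT = λ k → to (proj₁ (agree k)) (inT ρ k) }

  turning-path-agree : ∀ {i t} (ρ : Path (𝒯 a) (spine i)) → t + i ≤ m →
                       π ρ t ≡ spine (t + i) → π ρ (suc t) ≡ sideRoot (t + i) →
                       ∀ k → NodeAgree (π ρ k)
  turning-path-agree {i} {t} ρ t+i≤m on turn k with k ≤? t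
  ... | yes k≤t = subst NodeAgree (≡.sym (on-spine-before ρ on k≤t))
                    (mk⇔ (λ _ → main _) (λ _ → main _) ,
                     λ φ → spine-agree (k + i) φ (≤-trans (+-monoˡ-≤ i k≤t) t+i≤m))
  ... | no k≰t with x , e ← π-prefix ρ (≰⇒> k≰t) =
    subst NodeAgree (≡.sym (≡.trans e (cong (_++ x) turn)))
      (proj₁ (SameSubtree-root below) , λ φ _ → SameSubtree-Sat φ below)
    where
    below : SameSubtree a b (sideRoot (t + i) ++ x) (sideRoot (t + i) ++ x)
    below = SameSubtree-++ (sideRoot-same (t + i) t+i≤m) x

  E-along-turning-path : ∀ {i t} ψ (ρ : Path (𝒯 a) (spine i)) → t + i ≤ m →
                         π ρ t ≡ spine (t + i) → π ρ (suc t) ≡ sideRoot (t + i) → leafSize ψ ≤ c →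
                         Semantics.⊨ₚ (𝒯 a) (π ρ) 0 ψ → Sat b (spine i) (E ψ)
  E-along-turning-path ψ ρ t+i≤m on turn = E-along ψ ρ (turning-path-agree ρ t+i≤m on turn)

module SpineAgreement (n : ℕ) where

  Agree : List Bool → SF ⊤ → Set
  Agree w φ = Sat n w φ ⇔ Sat (suc n) w φ

  SpineAgree : SF ⊤ → Set
  SpineAgree φ = ∀ i → i + ∣ φ ∣ₛ ≤ n → Agree (spine i) φ

  sideRoot-SameSubtree-≤ : ∀ {j} → j ≤ n → SameSubtree n (suc n) (sideRoot j) (sideRoot j)
  sideRoot-SameSubtree-≤ j≤n = sideRoot-SameSubtree (<⇒≢ (s≤s j≤n)) (<⇒≢ (s≤s (m≤n⇒m≤1+n j≤n)))

  module _ {i : ℕ} (ψ : PF ⊤) (i+Eψ≤n : i + ∣ E ψ ∣ₛ ≤ n)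
           (ih : ∀ {φ} → ∣ φ ∣ₛ ≤ leafSize ψ → SpineAgree φ) where

    private
      d : ℕ
      d = nextCount ψ

      d+i+leafSize≤n : d + i + leafSize ψ ≤ n
      d+i+leafSize≤n = begin
        d + i + leafSize ψ   ≡⟨ cong (_+ leafSize ψ) (+-comm d i) ⟩
        i + d + leafSize ψ   ≡⟨ +-assoc i d (leafSize ψ) ⟩
        i + (d + leafSize ψ) ≤⟨ +-monoʳ-≤ i (m≤n⇒m≤1+n (nextCount+leafSize≤∣∣ₚ ψ)) ⟩
        i + ∣ E ψ ∣ₛ          ≤⟨ i+Eψ≤n ⟩
        n                    ∎
        where open ≤-Reasoning

      spine-agree-within : ∀ j φ → j ≤ d + i → ∣ φ ∣ₛ ≤ leafSize ψ → Agree (spine j) φ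
      spine-agree-within j φ j≤ φ≤ = ih φ≤ j (≤-trans (+-mono-≤ j≤ φ≤) d+i+leafSize≤n)

      sideRoot-same-within : ∀ j → j ≤ d + i → SameSubtree n (suc n) (sideRoot j) (sideRoot j)
      sideRoot-same-within j j≤ = sideRoot-SameSubtree-≤ (≤-trans j≤ (m+n≤o⇒m≤o _ d+i+leafSize≤n))

      module Forward = TurningPaths spine-agree-within sideRoot-same-within
      module Backward = TurningPaths (λ j φ j≤ φ≤ → ⇔.sym (spine-agree-within j φ j≤ φ≤))
                                     (λ j j≤ → SameSubtree-sym (sideRoot-same-within j j≤))

      stretched-agree : (ρ : Path (𝒯 n) (spine i)) (ρ′ : Path (𝒯 (suc n)) (spine i)) →
                        (∀ k → false ∷ π ρ k ≡ π ρ′ (suc k)) → π ρ d ≡ spine (d + i) →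
                        Semantics.⊨ₚ (𝒯 n) (π ρ) 0 ψ ⇔ Semantics.⊨ₚ (𝒯 (suc n)) (π ρ′) 0 ψ
      stretched-agree ρ ρ′ shifted on = ⊨ₚ-stutter early delayed ψ 0 ≤-refl ≤-refl
        where
        ρ′-on : ∀ k → k ≤ d → π ρ′ k ≡ spine (k + i)
        ρ′-on zero    _   = start ρ′
        ρ′-on (suc k) k<d =
          ≡.trans (≡.sym (shifted k)) (cong (false ∷_) (on-spine-before ρ on (<⇒≤ k<d)))
        early : ∀ k φ → k ≤ d → ∣ φ ∣ₛ ≤ leafSize ψ → Sat n (π ρ k) φ ⇔ Sat (suc n) (π ρ′ k) φ
        early k φ k≤d φ≤ =
          subst₂ (λ w w′ → Sat n w φ ⇔ Sat (suc n) w′ φ)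
                 (≡.sym (on-spine-before ρ on k≤d)) (≡.sym (ρ′-on k k≤d))
                 (spine-agree-within (k + i) φ (+-monoˡ-≤ i k≤d) φ≤)
        delayed : ∀ k φ → ∣ φ ∣ₛ ≤ leafSize ψ → Sat n (π ρ k) φ ⇔ Sat (suc n) (π ρ′ (suc k)) φ
        delayed k φ _ = subst (λ w → Sat n (π ρ k) φ ⇔ Sat (suc n) w φ) (shifted k)
                              (SameSubtree-Sat φ (false∷-SameSubtree (π ρ k)))

    E-agree : Agree (spine i) (E ψ)
    E-agree = mk⇔ forward backward
      where
      forward : Sat n (spine i) (E ψ) → Sat (suc n) (spine i) (E ψ)
      forward (ρ , sat) with spine-or-turn ρ (suc d)
      ... | inj₁ on =
        stretch ρ , to (stretched-agree ρ (stretch ρ) (stretch-suc ρ) (on-spine-before ρ on (n≤1+n d))) sat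
      ... | inj₂ (t , s≤s t≤d , on , turn) =
        Forward.E-along-turning-path ψ ρ (+-monoˡ-≤ i t≤d) on turn ≤-refl sat
      backward : Sat (suc n) (spine i) (E ψ) → Sat n (spine i) (E ψ)
      backward (ρ′ , sat) with spine-or-turn ρ′ (suc d)
      ... | inj₁ on =
        ρ , from (stretched-agree ρ ρ′ shifted (∷-injectiveʳ (≡.trans (shifted d) on))) sat
        where
        ρ : Path (𝒯 n) (spine i)
        ρ = unstretch ρ′ (on-spine-before ρ′ on (s≤s z≤n))
        shifted : ∀ k → false ∷ π ρ k ≡ π ρ′ (suc k)
        shifted = unstretch-suc ρ′ _
      ... | inj₂ (t , s≤s t≤d , on , turn) =
        Backward.E-along-turning-path ψ ρ′ (+-monoˡ-≤ i t≤d) on turn ≤-refl sat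

  spine-agree : ∀ φ → SpineAgree φ
  spine-agree = size-induction SpineAgree spine-agree-step
    where
    spine-agree-step : ∀ φ → (∀ {χ} → ∣ χ ∣ₛ < ∣ φ ∣ₛ → SpineAgree χ) → SpineAgree φ
    spine-agree-step tt'      _  _ _ = ⇔.refl
    spine-agree-step (atom _) _  _ _ = ⇔.refl
    spine-agree-step (¬ₛ φ)   ih i ≤n =
      ¬-cong-⇔ (ih {φ} ≤-refl i (≤-trans (+-monoʳ-≤ i (n≤1+n _)) ≤n))
    spine-agree-step (φ ∧ₛ χ) ih i ≤n =
      ih {φ} (s≤s (m≤m+n _ _)) i (≤-trans (+-monoʳ-≤ i (m≤n⇒m≤1+n (m≤m+n _ _))) ≤n) ×-⇔
      ih {χ} (s≤s (m≤n+m _ _)) i (≤-trans (+-monoʳ-≤ i (m≤n⇒m≤1+n (m≤n+m _ _))) ≤n)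
    spine-agree-step (Dᶜ m 1≤m φ) ih i ≤n = Dᶜ-cong {1≤m = 1≤m} {φ} children
      where
      children : ∀ d → (Tn n (spine i ∷ʳ d) × Sat n (spine i ∷ʳ d) φ) ⇔
                       (Tn (suc n) (spine i ∷ʳ d) × Sat (suc n) (spine i ∷ʳ d) φ)
      children false rewrite spine-∷ʳ i =
        mk⇔ (λ _ → main _) (λ _ → main _) ×-⇔ ih {φ} ≤-refl (suc i) (subst (_≤ n) (+-suc i _) ≤n)
      children true = proj₁ (SameSubtree-root below) ×-⇔ SameSubtree-Sat φ below
        where
        below : SameSubtree n (suc n) (sideRoot i) (sideRoot i)
        below = sideRoot-SameSubtree-≤ (m+n≤o⇒m≤o i ≤n)
    spine-agree-step (E ψ) ih i ≤n = E-agree ψ ≤n (λ φ≤ → ih (s≤s (≤-trans φ≤ (leafSize≤∣∣ₚ ψ))))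

lemma23 : ∀ (n : ℕ) → 1 ≤ n → (φ : SF ⊤) → ∣ φ ∣ₛ ≤ n → (𝒯 n ⊨ φ) ⇔ (𝒯 (suc n) ⊨ φ)
lemma23 n _ φ φ≤n = SpineAgreement.spine-agree n φ 0 φ≤n
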